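{- In signed permutation Mastermind on $n$ slots and colors, let $q^{(1)},q^{(2)},s\in\{ -n,\dots,n\}^n$ be three signed queries with pairwise disjoint supports, where $s$ is a zero-one query. Then $b_c(q^{(1)})$, $b_c(q^{(2)})$ and $b_c(s)$ can be determined by making only two signed queries.
   Context: Signed permutation Mastermind: the hidden codeword $c$ is a permutation of $[n]$; a signed query $q\in\{ -n,\dots,n\}^n$ receives the answer $b_c(q)=|\{i\in[n]: c_i=q_i\}|-|\{i\in[n]: c_i=-q_i\}|$. The support of a query $q$ is $\{i\in[n]: q_i\neq 0\}$. A zero-one query is a query consisting of a single color $f$ placed on some set of positions (and $0$ elsewhere), so that its answer is always $0$ or $1$. -}

module Defs where

open import Data.Nat using (ℕ; suc)
open import Data.Integer using (ℤ; +_; -_; _-_; ∣_∣; 0ℤ)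
import Data.Integer as ℤ
open import Data.Fin using (Fin; toℕ)
open import Data.Fin.Permutation using (Permutation′; _⟨$⟩ʳ_)
open import Data.List using (List; length; filter)
open import Data.List using () renaming (allFin to allFinL)
open import Data.Sum using (_⊎_)
open import Data.Product using (∃; _×_)
open import Relation.Binary.PropositionalEquality using (_≡_)
open import Relation.Nullary using (¬_)

-- A codeword: a permutation of [n]; slot i (0-based Fin n) holds colour (c i) + 1 ∈ {1,…,n}.
Codeword : ℕ → Set
Codeword n = Permutation′ n

colour : ∀ {n} → Codeword n → Fin n → ℤ
colour c i = + suc (toℕ (c ⟨$⟩ʳ i))

Query : ℕ → Set
Query n = Fin n → ℤ

ValidQuery : ∀ n → Query n → Set
ValidQuery n q = ∀ i → ∣ q i ∣ Data.Nat.≤ n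
  where import Data.Nat

answer : ∀ {n} → Codeword n → Query n → ℤ
answer {n} c q =
  + length (filter (λ i → colour c i ℤ.≟ q i) (allFinL n))
  - + length (filter (λ i → colour c i ℤ.≟ - q i) (allFinL n))

DisjointSupports : ∀ {n} → Query n → Query n → Set
DisjointSupports q r = ∀ i → q i ≡ 0ℤ ⊎ r i ≡ 0ℤ

ZeroOneQuery : ∀ n → Query n → Set
ZeroOneQuery n s = ∃ λ (f : Fin n) → ∀ i → s i ≡ 0ℤ ⊎ s i ≡ + suc (toℕ f)

-- Answers are additive over queries with disjoint supports and change sign with the query, so
-- r₁ = q₁ + q₂ + s and r₂ = q₂ − q₁ are answered by b₁ + b₂ + bₛ and b₂ − b₁. Their sum is
-- 2 b₂ + bₛ with bₛ ∈ {0, 1}, so halving it with remainder recovers b₂ and bₛ, and then b₁.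
module Submission where

open import Defs
open import Data.Nat using (ℕ)
open import Data.Integer using (ℤ)
open import Data.Product using (Σ; _×_; _,_; proj₁; proj₂)
open import Relation.Binary.PropositionalEquality using (_≡_)

open import Data.Nat as ℕ using (zero; suc; NonZero; _<_; _⊔_; s≤s; z≤n)
import Data.Nat.Properties as ℕ
open import Data.Integer using (+_; -[1+_]; -_; _+_; _-_; _*_; _⊖_; 0ℤ; 1ℤ; ∣_∣; _≟_)
open import Data.Integer.Properties
  using (neg-involutive; neg-distrib-+; +-identityˡ; +-identityʳ; +-injective;
         ∣-i∣≡∣i∣; ∣i*j∣≡∣i∣*∣j∣; ∣i∣≡0⇒i≡0; i-j≡0⇒i≡j; m-n≡m⊖n; ∣m⊝n∣≤m⊔n; +-0-commutativeMonoid; +-0-abelianGroup)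
open import Algebra.Properties.AbelianGroup +-0-abelianGroup using (∙-cancelʳ)
open import Data.Integer.DivMod using (_/ℕ_; _%ℕ_; a≡a%ℕn+[a/ℕn]*n; n%ℕd<d)
open import Data.Integer.Tactic.RingSolver using (solve-∀)
open import Data.Fin using (Fin; toℕ; punchIn)
open import Data.Fin.Properties using (toℕ-injective; punchInᵢ≢i)
open import Data.Fin.Permutation using (_⟨$⟩ʳ_; _⟨$⟩ˡ_; inverseˡ; inverseʳ)
open import Data.Vec.Functional using (zipWith; map; replicate)
open import Data.List using (length; filter; tabulate)
open import Data.Sum as Sum using (_⊎_; inj₁; inj₂)
open import Function using (_∘_)
open import Relation.Nullary using (Dec; yes; no; contradiction)
open import Relation.Unary using (Pred; Decidable)
open import Relation.Binary.PropositionalEquality using (_≢_; refl; sym; trans; cong; cong₂; subst; module ≡-Reasoning)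
open import Algebra.Properties.CommutativeMonoid.Sum +-0-commutativeMonoid
  using (sum; sum-syntax; ∑-distrib-+; sum-cong-≗; sum-remove; sum-replicate-zero)

private variable
  n : ℕ

divMod-unique : ∀ {d r r′} q q′ → r < d → r′ < d → + r + q * + d ≡ + r′ + q′ * + d → q ≡ q′
divMod-unique {d} {r} {r′} q q′ r<d r′<d eq = i-j≡0⇒i≡j q q′ (∣i∣≡0⇒i≡0 ∣q-q′∣≡0)
  where
  scaled : (q - q′) * + d ≡ r′ ⊖ r
  scaled = begin
    (q - q′) * + d                         ≡⟨ shift (+ r) q q′ (+ d) ⟩
    + r + q * + d - (+ r + q′ * + d)       ≡⟨ cong (_- (+ r + q′ * + d)) eq ⟩
    + r′ + q′ * + d - (+ r + q′ * + d)     ≡⟨ cancel (+ r) (+ r′) q′ (+ d) ⟩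
    + r′ - + r                             ≡⟨ m-n≡m⊖n r′ r ⟩
    r′ ⊖ r                                 ∎
    where
    open ≡-Reasoning
    shift : ∀ r q q′ d → (q - q′) * d ≡ r + q * d - (r + q′ * d)
    shift = solve-∀
    cancel : ∀ r r′ q′ d → r′ + q′ * d - (r + q′ * d) ≡ r′ - r
    cancel = solve-∀
  bound : ∣ q - q′ ∣ ℕ.* d < 1 ℕ.* d
  bound = begin-strict
    ∣ q - q′ ∣ ℕ.* d     ≡⟨ sym (∣i*j∣≡∣i∣*∣j∣ (q - q′) (+ d)) ⟩
    ∣ (q - q′) * + d ∣   ≡⟨ cong ∣_∣ scaled ⟩
    ∣ r′ ⊖ r ∣           ≤⟨ ∣m⊝n∣≤m⊔n r′ r ⟩
    r′ ⊔ r               <⟨ ℕ.⊔-lub r′<d r<d ⟩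
    d                    ≡⟨ sym (ℕ.*-identityˡ d) ⟩
    1 ℕ.* d              ∎
    where open ℕ.≤-Reasoning
  ∣q-q′∣≡0 : ∣ q - q′ ∣ ≡ 0
  ∣q-q′∣≡0 = ℕ.n<1⇒n≡0 (ℕ.*-cancelʳ-< _ _ _ bound)

/ℕ-%ℕ-unique : ∀ {d} .{{_ : NonZero d}} r q → r < d →
  (+ r + q * + d) /ℕ d ≡ q × (+ r + q * + d) %ℕ d ≡ r
/ℕ-%ℕ-unique {d} r q r<d = q′≡q , +-injective (∙-cancelʳ ((t /ℕ d) * + d) _ _ remainders)
  where
  t = + r + q * + d
  q′≡q : t /ℕ d ≡ q
  q′≡q = divMod-unique _ q (n%ℕd<d t d) r<d (sym (a≡a%ℕn+[a/ℕn]*n t d))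
  remainders : + (t %ℕ d) + (t /ℕ d) * + d ≡ + r + (t /ℕ d) * + d
  remainders = trans (sym (a≡a%ℕn+[a/ℕn]*n t d)) (cong (λ q′ → + r + q′ * + d) (sym q′≡q))

indicator : ∀ {p} {P : Set p} → Dec P → ℤ
indicator (yes _) = 1ℤ
indicator (no _)  = 0ℤ

length-filter-tabulate : ∀ {a p} {A : Set a} {P : Pred A p} (P? : Decidable P) {m} (g : Fin m → A) →
  + length (filter P? (tabulate g)) ≡ ∑[ i < m ] indicator (P? (g i))
length-filter-tabulate P? {zero}  g = refl
length-filter-tabulate P? {suc m} g with P? (g Fin.zero)
... | yes _ = cong (_+_ 1ℤ) (length-filter-tabulate P? (g ∘ Fin.suc))
... | no _  = trans (length-filter-tabulate P? (g ∘ Fin.suc)) (sym (+-identityˡ _))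

∑-neg : ∀ {m} (f : Fin m → ℤ) → ∑[ i < m ] (- f i) ≡ - ∑[ i < m ] f i
∑-neg {zero}  f = refl
∑-neg {suc m} f = trans (cong (_+_ (- f Fin.zero)) (∑-neg (f ∘ Fin.suc))) (sym (neg-distrib-+ (f Fin.zero) _))

score : ℤ → ℤ → ℤ
score v w = indicator (v ≟ w) - indicator (v ≟ - w)

answer≡∑score : (c : Codeword n) (q : Query n) → answer c q ≡ ∑[ i < n ] score (colour c i) (q i)
answer≡∑score {n} c q = begin
  answer c q
    ≡⟨ cong₂ _-_ (length-filter-tabulate (λ i → colour c i ≟ q i) (λ i → i))
                 (length-filter-tabulate (λ i → colour c i ≟ - q i) (λ i → i)) ⟩
  ∑[ i < n ] hit i - ∑[ i < n ] antihit i
    ≡⟨ cong (_+_ (∑[ i < n ] hit i)) (sym (∑-neg antihit)) ⟩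
  ∑[ i < n ] hit i + ∑[ i < n ] (- antihit i)
    ≡⟨ sym (∑-distrib-+ hit (λ i → - antihit i)) ⟩
  ∑[ i < n ] score (colour c i) (q i) ∎
  where
  open ≡-Reasoning
  hit antihit : Fin n → ℤ
  hit i = indicator (colour c i ≟ q i)
  antihit i = indicator (colour c i ≟ - q i)

score-0 : ∀ {v} → v ≢ 0ℤ → score v 0ℤ ≡ 0ℤ
score-0 {v} v≢0 with v ≟ 0ℤ
... | yes v≡0 = contradiction v≡0 v≢0
... | no _    = refl

score-neg : ∀ v w → score v (- w) ≡ - score v w
score-neg v w rewrite neg-involutive w = swap (indicator (v ≟ w)) (indicator (v ≟ - w))
  where
  swap : ∀ a b → b - a ≡ - (a - b)
  swap = solve-∀

score-+ : ∀ {v} → v ≢ 0ℤ → ∀ {w w′} → w ≡ 0ℤ ⊎ w′ ≡ 0ℤ → score v (w + w′) ≡ score v w + score v w′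
score-+ {v} v≢0 {w′ = w′} (inj₁ refl) = begin
  score v (0ℤ + w′)       ≡⟨ cong (score v) (+-identityˡ w′) ⟩
  score v w′              ≡⟨ sym (+-identityˡ _) ⟩
  0ℤ + score v w′         ≡⟨ cong (_+ score v w′) (sym (score-0 v≢0)) ⟩
  score v 0ℤ + score v w′ ∎
  where open ≡-Reasoning
score-+ {v} v≢0 {w} (inj₂ refl) = begin
  score v (w + 0ℤ)        ≡⟨ cong (score v) (+-identityʳ w) ⟩
  score v w               ≡⟨ sym (+-identityʳ _) ⟩
  score v w + 0ℤ          ≡⟨ cong (_+_ (score v w)) (sym (score-0 v≢0)) ⟩
  score v w + score v 0ℤ  ∎
  where open ≡-Reasoning

score-self : ∀ k → score (+ suc k) (+ suc k) ≡ 1ℤ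
score-self k with + suc k ≟ + suc k | + suc k ≟ -[1+ k ]
... | yes _ | no _ = refl
... | no ¬p | _    = contradiction refl ¬p
... | _     | yes ()

score-≢ : ∀ {k m} → k ≢ m → score (+ suc k) (+ suc m) ≡ 0ℤ
score-≢ {k} {m} k≢m with + suc k ≟ + suc m | + suc k ≟ -[1+ m ]
... | no _    | no _ = refl
... | yes k≡m | _    = contradiction (ℕ.suc-injective (+-injective k≡m)) k≢m
... | _       | yes ()

colour≢0 : (c : Codeword n) (i : Fin n) → colour c i ≢ 0ℤ
colour≢0 c i ()

answer-+ : (c : Codeword n) {q r : Query n} → DisjointSupports q r →
  answer c (zipWith _+_ q r) ≡ answer c q + answer c r
answer-+ {n} c {q} {r} disj = begin
  answer c (zipWith _+_ q r)
    ≡⟨ answer≡∑score c _ ⟩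
  ∑[ i < n ] score (colour c i) (q i + r i)
    ≡⟨ sum-cong-≗ (λ i → score-+ (colour≢0 c i) (disj i)) ⟩
  ∑[ i < n ] (score (colour c i) (q i) + score (colour c i) (r i))
    ≡⟨ ∑-distrib-+ (λ i → score (colour c i) (q i)) (λ i → score (colour c i) (r i)) ⟩
  ∑[ i < n ] score (colour c i) (q i) + ∑[ i < n ] score (colour c i) (r i)
    ≡⟨ sym (cong₂ _+_ (answer≡∑score c q) (answer≡∑score c r)) ⟩
  answer c q + answer c r ∎
  where open ≡-Reasoning

answer-neg : (c : Codeword n) (q : Query n) → answer c (map (-_) q) ≡ - answer c q
answer-neg {n} c q = begin
  answer c (map (-_) q)                      ≡⟨ answer≡∑score c _ ⟩
  ∑[ i < n ] score (colour c i) (- q i)      ≡⟨ sum-cong-≗ (λ i → score-neg (colour c i) (q i)) ⟩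
  ∑[ i < n ] (- score (colour c i) (q i))    ≡⟨ ∑-neg (λ i → score (colour c i) (q i)) ⟩
  - ∑[ i < n ] score (colour c i) (q i)      ≡⟨ cong (-_) (sym (answer≡∑score c q)) ⟩
  - answer c q                               ∎
  where open ≡-Reasoning

-- Only the slot holding the colour f of s can score, and it scores 0 or 1.
answer-zeroOne : (c : Codeword n) (s : Query n) → ZeroOneQuery n s → answer c s ≡ 0ℤ ⊎ answer c s ≡ 1ℤ
answer-zeroOne {suc n} c s (f , s∈) = Sum.map (trans answer≡scoreᵢ₀) (trans answer≡scoreᵢ₀) scoreᵢ₀
  where
  open ≡-Reasoning
  i₀ = c ⟨$⟩ˡ f
  t : Fin (suc n) → ℤ
  t i = score (colour c i) (s i)
  elsewhere : ∀ i → i ≢ i₀ → t i ≡ 0ℤ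
  elsewhere i i≢i₀ with s∈ i
  ... | inj₁ sᵢ≡0 = trans (cong (score (colour c i)) sᵢ≡0) (score-0 (colour≢0 c i))
  ... | inj₂ sᵢ≡f = trans (cong (score (colour c i)) sᵢ≡f) (score-≢ (λ eq → i≢i₀ (begin
    i                            ≡⟨ inverseˡ c ⟨
    c ⟨$⟩ˡ (c ⟨$⟩ʳ i)            ≡⟨ cong (c ⟨$⟩ˡ_) (toℕ-injective eq) ⟩
    i₀                           ∎)))
  answer≡scoreᵢ₀ : answer c s ≡ score (+ suc (toℕ f)) (s i₀)
  answer≡scoreᵢ₀ = begin
    answer c s                               ≡⟨ answer≡∑score c s ⟩
    ∑[ i < suc n ] t i                       ≡⟨ sum-remove {i = i₀} t ⟩
    t i₀ + ∑[ j < n ] t (punchIn i₀ j)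
      ≡⟨ cong (_+_ (t i₀)) (sum-cong-≗ (λ j → elsewhere (punchIn i₀ j) (punchInᵢ≢i i₀ j))) ⟩
    t i₀ + sum (replicate n 0ℤ)              ≡⟨ cong (_+_ (t i₀)) (sum-replicate-zero n) ⟩
    t i₀ + 0ℤ                                ≡⟨ +-identityʳ _ ⟩
    t i₀                                     ≡⟨ cong (λ v → score v (s i₀)) (cong (+_ ∘ suc ∘ toℕ) (inverseʳ c)) ⟩
    score (+ suc (toℕ f)) (s i₀)             ∎
  scoreᵢ₀ : score (+ suc (toℕ f)) (s i₀) ≡ 0ℤ ⊎ score (+ suc (toℕ f)) (s i₀) ≡ 1ℤ
  scoreᵢ₀ with s∈ i₀
  ... | inj₁ sᵢ₀≡0 = inj₁ (trans (cong (score (+ suc (toℕ f))) sᵢ₀≡0) (score-0 {+ suc (toℕ f)} (λ ())))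
  ... | inj₂ sᵢ₀≡f = inj₂ (trans (cong (score (+ suc (toℕ f))) sᵢ₀≡f) (score-self (toℕ f)))

disjoint-sym : {q r : Query n} → DisjointSupports q r → DisjointSupports r q
disjoint-sym disj i = Sum.swap (disj i)

disjoint-negʳ : {q r : Query n} → DisjointSupports q r → DisjointSupports q (map (-_) r)
disjoint-negʳ disj i = Sum.map₂ (cong (-_)) (disj i)

disjoint-+ˡ : {q r s : Query n} → DisjointSupports q s → DisjointSupports r s →
  DisjointSupports (zipWith _+_ q r) s
disjoint-+ˡ dq dr i with dq i | dr i
... | inj₂ sᵢ≡0 | _         = inj₂ sᵢ≡0
... | _         | inj₂ sᵢ≡0 = inj₂ sᵢ≡0
... | inj₁ qᵢ≡0 | inj₁ rᵢ≡0 = inj₁ (cong₂ _+_ qᵢ≡0 rᵢ≡0)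

valid-neg : {q : Query n} → ValidQuery n q → ValidQuery n (map (-_) q)
valid-neg {q = q} valid i = subst (ℕ._≤ _) (sym (∣-i∣≡∣i∣ (q i))) (valid i)

valid-+ : {q r : Query n} → ValidQuery n q → ValidQuery n r → DisjointSupports q r →
  ValidQuery n (zipWith _+_ q r)
valid-+ {q = q} {r} vq vr disj i with disj i
... | inj₁ qᵢ≡0 = subst (ℕ._≤ _) (cong ∣_∣ (sym (trans (cong (_+ r i) qᵢ≡0) (+-identityˡ (r i))))) (vr i)
... | inj₂ rᵢ≡0 = subst (ℕ._≤ _) (cong ∣_∣ (sym (trans (cong (_+_ (q i)) rᵢ≡0) (+-identityʳ (q i))))) (vq i)

decode : ℤ → ℤ → ℤ × ℤ × ℤ
decode x y = (x + y) /ℕ 2 - y , (x + y) /ℕ 2 , + ((x + y) %ℕ 2)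

decode-correct : ∀ b₁ b₂ e → e < 2 → decode (b₁ + b₂ + + e) (b₂ - b₁) ≡ (b₁ , b₂ , + e)
decode-correct b₁ b₂ e e<2 = cong₂ _,_ first (cong₂ _,_ half (cong +_ parity))
  where
  x+y = b₁ + b₂ + + e + (b₂ - b₁)
  x+y≡ : x+y ≡ + e + b₂ * + 2
  x+y≡ = doubled b₁ b₂ (+ e)
    where
    doubled : ∀ b₁ b₂ bₛ → b₁ + b₂ + bₛ + (b₂ - b₁) ≡ bₛ + b₂ * + 2
    doubled = solve-∀
  half : x+y /ℕ 2 ≡ b₂
  half = trans (cong (_/ℕ 2) x+y≡) (proj₁ (/ℕ-%ℕ-unique e b₂ e<2))
  parity : x+y %ℕ 2 ≡ e
  parity = trans (cong (_%ℕ 2) x+y≡) (proj₂ (/ℕ-%ℕ-unique e b₂ e<2))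
  first : x+y /ℕ 2 - (b₂ - b₁) ≡ b₁
  first = trans (cong (_- (b₂ - b₁)) half) (cancel b₁ b₂)
    where
    cancel : ∀ b₁ b₂ → b₂ - (b₂ - b₁) ≡ b₁
    cancel = solve-∀

decode-correct-bit : ∀ b₁ b₂ bₛ → bₛ ≡ 0ℤ ⊎ bₛ ≡ 1ℤ → decode (b₁ + b₂ + bₛ) (b₂ - b₁) ≡ (b₁ , b₂ , bₛ)
decode-correct-bit b₁ b₂ _ (inj₁ refl) = decode-correct b₁ b₂ 0 (s≤s z≤n)
decode-correct-bit b₁ b₂ _ (inj₂ refl) = decode-correct b₁ b₂ 1 ℕ.≤-refl

lemma4 : (n : ℕ) (q₁ q₂ s : Query n) →
    ValidQuery n q₁ → ValidQuery n q₂ → ValidQuery n s →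
    DisjointSupports q₁ q₂ → DisjointSupports q₁ s → DisjointSupports q₂ s →
    ZeroOneQuery n s →
    Σ (Query n) λ r₁ → ValidQuery n r₁ ×
    Σ (ℤ → Query n) λ r₂ → (∀ a → ValidQuery n (r₂ a)) ×
    Σ (ℤ → ℤ → ℤ × ℤ × ℤ) λ decode →
      ∀ (c : Codeword n) →
        decode (answer c r₁) (answer c (r₂ (answer c r₁)))
          ≡ (answer c q₁ , answer c q₂ , answer c s)
lemma4 n q₁ q₂ s v₁ v₂ vₛ d₁₂ d₁ₛ d₂ₛ zo =
  r₁ , valid-+ (valid-+ v₁ v₂ d₁₂) vₛ (disjoint-+ˡ d₁ₛ d₂ₛ) ,
  (λ _ → r₂) , (λ _ → valid-+ v₂ (valid-neg {q = q₁} v₁) d₂₋₁) ,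
  decode , correct
  where
  r₁ r₂ : Query n
  r₁ = zipWith _+_ (zipWith _+_ q₁ q₂) s
  r₂ = zipWith _+_ q₂ (map (-_) q₁)
  d₂₋₁ : DisjointSupports q₂ (map (-_) q₁)
  d₂₋₁ = disjoint-negʳ (disjoint-sym d₁₂)
  answer-r₁ : ∀ c → answer c r₁ ≡ answer c q₁ + answer c q₂ + answer c s
  answer-r₁ c = trans (answer-+ c (disjoint-+ˡ d₁ₛ d₂ₛ)) (cong (_+ answer c s) (answer-+ c d₁₂))
  answer-r₂ : ∀ c → answer c r₂ ≡ answer c q₂ - answer c q₁
  answer-r₂ c = trans (answer-+ c d₂₋₁) (cong (_+_ (answer c q₂)) (answer-neg c q₁))
  correct : ∀ c → decode (answer c r₁) (answer c r₂) ≡ (answer c q₁ , answer c q₂ , answer c s)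
  correct c = trans (cong₂ decode (answer-r₁ c) (answer-r₂ c))
                    (decode-correct-bit _ _ _ (answer-zeroOne c s zo))
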